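{- Let $n\ge4$ and $S \subseteq \binom{[n]}{2}$. Then $S$ is independent in $M(\textnormal{Cat}(n))$ if and only if the graph $G(S)$ contains no closed trail with alternating vertices, that is, no closed trail $v_0,v_1,\dots,v_{2k-1}$ (indices modulo $2k$) with $v_{2i-1}<v_{2i}$ and $v_{2i+1} < v_{2i}$ for each $i=0,\dots,k-1$.
   Context: $G(S)$ is the graph with vertex set $[n]$ and edge set $S$. A closed trail is a sequence of vertices $v_0,\dots,v_{m}$ with $v_m=v_0$, each consecutive pair an edge, and no edge repeated. $\textnormal{Cat}(n)$ is the binary tree (all internal vertices of degree 3) with leaves labeled by $[n]$ having exactly two cherries, $\{1,2\}$ and $\{n-1,n\}$ (a cherry is a pair of leaves adjacent to a common vertex), such that the remaining leaves $3,4,\dots,n-2$ are attached in increasing order along the path from the $\{1,2\}$ cherry to the $\{n-1,n\}$ cherry. For a tree $T$ with edge set $E$ and leaves $[n]$, and $ij\in\binom{[n]}{2}$, $\lambda_T(ij)\in\mathbb{R}^E$ is the indicator vector of edges on the path from leaf $i$ to leaf $j$; $M(T)$ is the linear matroid on $\binom{[n]}{2}$ in which $S$ is independent iff $\{\lambda_T(ij)\}_{ij\in S}$ is linearly independent.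
   Formalization: Linear independence of the vectors $\lambda_T(ij)$ defining M(Cat(n)) is taken over ℚ rather than ℝ. -}

module Defs where

open import Data.Bool using (Bool; true; false; if_then_else_; _∧_; _∨_; T)
open import Data.Nat as ℕ using (ℕ; zero; suc; _+_; _∸_; _≤ᵇ_; _<ᵇ_; _⊔_; _⊓_)
open import Data.Nat.DivMod using (_mod_; _%_)
open import Data.Fin as Fin using (Fin; toℕ)
open import Data.Fin.Properties using (_≟_)
open import Data.Rational using (ℚ; 0ℚ; 1ℚ; _*_) renaming (_+_ to _+ℚ_)
open import Data.Sum using (_⊎_)
open import Data.Product using (Σ; _×_)
open import Relation.Nullary using (¬_; ⌊_⌋)
open import Relation.Binary.PropositionalEquality using (_≡_; _≢_)

-- Leaves are labelled by Fin n (label i stands for leaf i+1 of [n]);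
-- the order on labels is the order of toℕ.

-- The caterpillar tree Cat(n), n ≥ 4.
-- Internal vertices c_0, …, c_{n-3} (n-2 of them) form the spine.
-- Leaves 0,1 (the cherry {1,2}) hang at c_0; leaf l (2 ≤ l ≤ n-3) hangs at
-- c_{l-1}; leaves n-2, n-1 (the cherry {n-1,n}) hang at c_{n-3}.
-- Edges: one pendant edge per leaf, and spine edges s_k = c_k c_{k+1}
-- for k = 0, …, n-4.  Total 2n-3 edges.

data CatEdge (n : ℕ) : Set where
  pendant : Fin n → CatEdge n
  spine   : Fin (n ∸ 3) → CatEdge n

attach : (n : ℕ) → Fin n → ℕ
attach n l = (toℕ l ∸ 1) ⊓ (n ∸ 3)

onPath : (n : ℕ) → Fin n → Fin n → CatEdge n → Bool
onPath n i j (pendant l) = ⌊ l ≟ i ⌋ ∨ ⌊ l ≟ j ⌋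
onPath n i j (spine k) =
  ((attach n i ⊓ attach n j) ≤ᵇ toℕ k) ∧ (toℕ k <ᵇ (attach n i ⊔ attach n j))

λCat : (n : ℕ) → Fin n → Fin n → CatEdge n → ℚ
λCat n i j e = if onPath n i j e then 1ℚ else 0ℚ

-- Edge sets S ⊆ ([n] choose 2): S i j (for i < j) says {i,j} ∈ S.
-- Values S i j with i ≥ j are ignored.

EdgeSet : ℕ → Set
EdgeSet n = Fin n → Fin n → Bool

sumFin : (m : ℕ) → (Fin m → ℚ) → ℚ
sumFin zero    f = 0ℚ
sumFin (suc m) f = f Fin.zero +ℚ sumFin m (λ i → f (Fin.suc i))

combo : (n : ℕ) → EdgeSet n → (Fin n → Fin n → ℚ) → CatEdge n → ℚ
combo n S c e =
  sumFin n (λ i → sumFin n (λ j →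
    if (toℕ i <ᵇ toℕ j) ∧ S i j then c i j * λCat n i j e else 0ℚ))

-- S independent in M(Cat(n)): the vectors λ(ij), ij ∈ S, are linearly
-- independent (over ℚ; they are 0/1-vectors so this agrees with ℝ).
IndependentCat : (n : ℕ) → EdgeSet n → Set
IndependentCat n S =
  (c : Fin n → Fin n → ℚ) →
  ((e : CatEdge n) → combo n S c e ≡ 0ℚ) →
  (i j : Fin n) → toℕ i ℕ.< toℕ j → T (S i j) → c i j ≡ 0ℚ

Adj : (n : ℕ) → EdgeSet n → Fin n → Fin n → Set
Adj n S a b = (toℕ a ℕ.< toℕ b × T (S a b)) ⊎ (toℕ b ℕ.< toℕ a × T (S b a))

SameEdge : {n : ℕ} → Fin n → Fin n → Fin n → Fin n → Set
SameEdge a b c d = (a ≡ c × b ≡ d) ⊎ (a ≡ d × b ≡ c)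

next : (m : ℕ) → Fin (suc m) → Fin (suc m)
next m i = suc (toℕ i) mod (suc m)

-- A closed trail with alternating vertices of length 2k (k = suc k'),
-- v_0, …, v_{2k-1}, indices modulo 2k:
--  * each {v_i, v_{i+1}} is an edge of G(S),
--  * no edge repeated,
--  * v_{i+1} < v_i for i even and v_i < v_{i+1} for i odd
--    (i.e. v_{2i-1} < v_{2i} and v_{2i+1} < v_{2i}).
record AltClosedTrail (n : ℕ) (S : EdgeSet n) (k' : ℕ) : Set where
  field
    v        : Fin (suc (k' + suc k')) → Fin n
    edges    : (i : Fin (suc (k' + suc k'))) → Adj n S (v i) (v (next (k' + suc k') i))
    distinct : (i j : Fin (suc (k' + suc k'))) → i ≢ j →
               ¬ SameEdge (v i) (v (next (k' + suc k') i)) (v j) (v (next (k' + suc k') j))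
    altEven  : (i : Fin (suc (k' + suc k'))) → toℕ i % 2 ≡ 0 →
               toℕ (v (next (k' + suc k') i)) ℕ.< toℕ (v i)
    altOdd   : (i : Fin (suc (k' + suc k'))) → toℕ i % 2 ≡ 1 →
               toℕ (v i) ℕ.< toℕ (v (next (k' + suc k') i))

HasAltClosedTrail : (n : ℕ) → EdgeSet n → Set
HasAltClosedTrail n S = Σ ℕ (λ k' → AltClosedTrail n S k')

module Submission where

-- Read a coefficient family c as a weighting of the edges of G(S).  The
-- coordinate of Σ c_ij λ(ij) on the pendant edge of a leaf l is the total
-- weight at l, and on a spine edge it is the net weight crossing the cut
-- between the leaves to its left and to its right.  Hence c is a linear
-- relation iff it is balanced: at every vertex v the weights of the edges
-- from v up to larger neighbours sum to 0, and so do those of the edges from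
-- smaller neighbours down to v (balanced⇒relation, relation⇒balanced).
-- The rest is combinatorics of zigzags, closed walks p_0 > q_0 < p_1 > q_1 …
-- alternating between peaks and valleys:
--  * an alternating closed trail is a zigzag traversing its first edge once;
--    weighting its descents +1 and ascents −1 gives a balanced weighting that
--    is nonzero on S (trail⇒dependent);
--  * from a balanced weighting nonzero on some edge, walking on nonzero edges
--    and never turning back along the same edge, the first repeated peak
--    closes a simple zigzag, which is an alternating closed trail
--    (Walk, SimpleTrail, no-trail⇒independent).

open import Defs
open import Data.Nat using (ℕ; _≤_)
open import Data.Product using (_×_)
open import Relation.Nullary using (¬_)

open import Algebra.Bundles using (CommutativeMonoid)
open import Data.Bool using (Bool; true; false; if_then_else_; _∧_; T)
open import Data.Bool.Properties using (T-∧)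
open import Data.Empty using (⊥-elim)
open import Data.Fin as Fin using (Fin; toℕ; fromℕ<)
open import Data.Fin.Properties
  using (_≟_; suc-injective; toℕ-injective; toℕ<n; toℕ-fromℕ; toℕ-fromℕ<; toℕ-inject;
         ¬∀⟶∃¬; ¬∀⟶∃¬-smallest; pigeonhole; any?)
open import Data.Nat as ℕ using (zero; suc; _+_; _%_; _∸_; _<_; _≤ᵇ_; _<ᵇ_; z≤n; s≤s)
import Data.Nat.Properties as ℕP
open import Data.Nat.DivMod using (_mod_; m<n⇒m%n≡m; n%n≡0)
open import Data.Product using (Σ; _,_; proj₁; proj₂)
open import Data.Rational using (ℚ; 0ℚ; 1ℚ; _*_; -_; _-_; ½) renaming (_+_ to _+ℚ_)
import Data.Rational.Properties as ℚP
open import Data.Rational.Solver using (module +-*-Solver)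
open +-*-Solver using (solve; _:+_; _:-_; _:=_)
open import Data.Sum using (_⊎_; inj₁; inj₂)
open import Data.Unit using (tt)
open import Function.Bundles using (Equivalence; _⇔_; mk⇔)
open import Function.Base using (_∘_; case_of_; flip)
open import Relation.Binary.Definitions using (tri<; tri≈; tri>)
open import Relation.Binary.PropositionalEquality
open import Relation.Nullary using (⌊_⌋; yes; no)
open import Relation.Nullary.Reflects using (ofʸ; ofⁿ)
open import Relation.Nullary.Decidable
  using (Dec; toWitness; fromWitness; _⊎-dec_; ¬?; decidable-stable)

open import Algebra.Properties.CommutativeSemigroup
  (CommutativeMonoid.commutativeSemigroup ℚP.+-0-commutativeMonoid) using (interchange)
open import Algebra.Properties.Group ℚP.+-0-group using (inverseʳ-unique; ⁻¹-involutive)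

guard : Bool → ℚ → ℚ
guard b x = if b then x else 0ℚ

guard-yes : ∀ {b} x → T b → guard b x ≡ x
guard-yes {true} x _ = refl

guard-no : ∀ {b} x → ¬ T b → guard b x ≡ 0ℚ
guard-no {true}  x ¬b = ⊥-elim (¬b tt)
guard-no {false} x ¬b = refl

guard-zero : ∀ b → guard b 0ℚ ≡ 0ℚ
guard-zero true  = refl
guard-zero false = refl

guard-comm : ∀ b b′ x → guard b (guard b′ x) ≡ guard b′ (guard b x)
guard-comm true  b′    x = refl
guard-comm false true  x = refl
guard-comm false false x = refl

double-zero : ∀ x → x +ℚ x ≡ 0ℚ → x ≡ 0ℚ
double-zero x x+x≡0 = begin
  x               ≡⟨ sym (ℚP.*-identityˡ x) ⟩
  1ℚ * x          ≡⟨ ℚP.*-distribʳ-+ x ½ ½ ⟩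
  ½ * x +ℚ ½ * x  ≡⟨ sym (ℚP.*-distribˡ-+ ½ x x) ⟩
  ½ * (x +ℚ x)    ≡⟨ cong (½ *_) x+x≡0 ⟩
  ½ * 0ℚ          ≡⟨ ℚP.*-zeroʳ ½ ⟩
  0ℚ              ∎
  where open ≡-Reasoning

sum-cong : ∀ m {f g : Fin m → ℚ} → (∀ i → f i ≡ g i) → sumFin m f ≡ sumFin m g
sum-cong zero    f≗g = refl
sum-cong (suc m) f≗g = cong₂ _+ℚ_ (f≗g Fin.zero) (sum-cong m (λ i → f≗g (Fin.suc i)))

sum-zero : ∀ m {f : Fin m → ℚ} → (∀ i → f i ≡ 0ℚ) → sumFin m f ≡ 0ℚ
sum-zero m f≗0 = trans (sum-cong m {g = λ _ → 0ℚ} f≗0) (zeros m)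
  where
  zeros : ∀ m → sumFin m (λ _ → 0ℚ) ≡ 0ℚ
  zeros zero    = refl
  zeros (suc m) = trans (ℚP.+-identityˡ _) (zeros m)

sum-+ : ∀ m (f g : Fin m → ℚ) → sumFin m (λ i → f i +ℚ g i) ≡ sumFin m f +ℚ sumFin m g
sum-+ zero    f g = refl
sum-+ (suc m) f g =
  trans (cong (f Fin.zero +ℚ g Fin.zero +ℚ_) (sum-+ m (f ∘ Fin.suc) (g ∘ Fin.suc)))
        (interchange (f Fin.zero) (g Fin.zero) _ _)

sum-neg : ∀ m (f : Fin m → ℚ) → sumFin m (λ i → - f i) ≡ - sumFin m f
sum-neg m f = inverseʳ-unique (sumFin m f) _ (begin
  sumFin m f +ℚ sumFin m (λ i → - f i)  ≡⟨ sym (sum-+ m f (λ i → - f i)) ⟩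
  sumFin m (λ i → f i - f i)            ≡⟨ sum-zero m (λ i → ℚP.+-inverseʳ (f i)) ⟩
  0ℚ                                    ∎)
  where open ≡-Reasoning

sum-- : ∀ m (f g : Fin m → ℚ) → sumFin m (λ i → f i - g i) ≡ sumFin m f - sumFin m g
sum-- m f g = trans (sum-+ m f (λ i → - g i)) (cong (sumFin m f +ℚ_) (sum-neg m g))

sum-swap : ∀ m k (f : Fin m → Fin k → ℚ) →
  sumFin m (λ i → sumFin k (f i)) ≡ sumFin k (λ j → sumFin m (λ i → f i j))
sum-swap zero    k f = sym (sum-zero k (λ _ → refl))
sum-swap (suc m) k f = trans (cong (sumFin k (f Fin.zero) +ℚ_) (sum-swap m k (f ∘ Fin.suc)))
                             (sym (sum-+ k (f Fin.zero) _))

sum-guard : ∀ m b (f : Fin m → ℚ) → sumFin m (λ i → guard b (f i)) ≡ guard b (sumFin m f)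
sum-guard m true  f = refl
sum-guard m false f = sum-zero m (λ _ → refl)

sum-single : ∀ m (f : Fin m → ℚ) a → (∀ i → i ≢ a → f i ≡ 0ℚ) → sumFin m f ≡ f a
sum-single (suc m) f Fin.zero f≗0 =
  trans (cong (f Fin.zero +ℚ_) (sum-zero m (λ i → f≗0 (Fin.suc i) λ ())))
        (ℚP.+-identityʳ (f Fin.zero))
sum-single (suc m) f (Fin.suc a) f≗0 =
  trans (cong₂ _+ℚ_ (f≗0 Fin.zero λ ())
                    (sum-single m (f ∘ Fin.suc) a (λ i i≢a → f≗0 (Fin.suc i) (i≢a ∘ suc-injective))))
        (ℚP.+-identityˡ (f (Fin.suc a)))

sum-point : ∀ m (f : Fin m → ℚ) a → sumFin m (λ i → guard ⌊ a ≟ i ⌋ (f i)) ≡ f a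
sum-point m f a =
  trans (sum-single m _ a (λ i i≢a → guard-no (f i) (λ a≡i → i≢a (sym (toWitness a≡i)))))
        (guard-yes (f a) (fromWitness refl))

telescope : ∀ k (A : ℕ → ℚ) → sumFin k (λ h → A (toℕ h) - A (suc (toℕ h))) ≡ A 0 - A k
telescope zero    A = sym (ℚP.+-inverseʳ (A 0))
telescope (suc k) A = begin
  (A 0 - A 1) +ℚ sumFin k (λ h → A (suc (toℕ h)) - A (suc (suc (toℕ h))))
    ≡⟨ cong (A 0 - A 1 +ℚ_) (telescope k (A ∘ suc)) ⟩
  (A 0 - A 1) +ℚ (A 1 - A (suc k))
    ≡⟨ solve 3 (λ a b c → (a :- b) :+ (b :- c) := a :- c) refl (A 0) (A 1) (A (suc k)) ⟩
  A 0 - A (suc k) ∎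
  where open ≡-Reasoning

below : ∀ {n} → ℕ → (Fin n → ℚ) → ℚ
below {n} m f = sumFin n (λ v → guard (toℕ v <ᵇ m) (f v))

below-zero : ∀ {n} m (f : Fin n → ℚ) → (∀ v → f v ≡ 0ℚ) → below m f ≡ 0ℚ
below-zero {n} m f f≗0 = sum-zero n (λ v → trans (cong (guard _) (f≗0 v)) (guard-zero _))

below-none : ∀ {n} (f : Fin n → ℚ) → below 0 f ≡ 0ℚ
below-none {n} f = sum-zero n (λ v → guard-no (f v) (ℕP.n≮0 ∘ ℕP.<ᵇ⇒< (toℕ v) 0))

below-all : ∀ {n} (f : Fin n → ℚ) → below n f ≡ sumFin n f
below-all {n} f = sum-cong n (λ v → guard-yes (f v) (ℕP.<⇒<ᵇ (toℕ<n v)))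

below-step : ∀ {n} (f : Fin n → ℚ) (a : Fin n) {m} → toℕ a ≡ m →
  below (suc m) f ≡ below m f +ℚ f a
below-step {n} f a {m} a≡m = begin
  below (suc m) f
    ≡⟨ sum-cong n split ⟩
  sumFin n (λ v → guard (toℕ v <ᵇ m) (f v) +ℚ guard ⌊ a ≟ v ⌋ (f v))
    ≡⟨ sum-+ n _ _ ⟩
  below m f +ℚ sumFin n (λ v → guard ⌊ a ≟ v ⌋ (f v))
    ≡⟨ cong (below m f +ℚ_) (sum-point n f a) ⟩
  below m f +ℚ f a ∎
  where
  open ≡-Reasoning
  a≡v⇒v≡m : ∀ {v} → a ≡ v → toℕ v ≡ m
  a≡v⇒v≡m refl = a≡m
  split : ∀ v → guard (toℕ v <ᵇ suc m) (f v) ≡ guard (toℕ v <ᵇ m) (f v) +ℚ guard ⌊ a ≟ v ⌋ (f v)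
  split v with ℕP.<-cmp (toℕ v) m
  ... | tri< v<m _ _ = begin
    guard (toℕ v <ᵇ suc m) (f v)  ≡⟨ guard-yes (f v) (ℕP.<⇒<ᵇ (ℕP.m<n⇒m<1+n v<m)) ⟩
    f v                           ≡⟨ sym (ℚP.+-identityʳ (f v)) ⟩
    f v +ℚ 0ℚ                     ≡⟨ sym (cong₂ _+ℚ_ (guard-yes (f v) (ℕP.<⇒<ᵇ v<m))
                                                     (guard-no (f v) (ℕP.<⇒≢ v<m ∘ a≡v⇒v≡m ∘ toWitness))) ⟩
    guard (toℕ v <ᵇ m) (f v) +ℚ guard ⌊ a ≟ v ⌋ (f v) ∎
  ... | tri≈ _ v≡m _ = begin
    guard (toℕ v <ᵇ suc m) (f v)  ≡⟨ guard-yes (f v) (ℕP.<⇒<ᵇ (ℕP.≤-reflexive (cong suc v≡m))) ⟩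
    f v                           ≡⟨ sym (ℚP.+-identityˡ (f v)) ⟩
    0ℚ +ℚ f v                     ≡⟨ sym (cong₂ _+ℚ_ (guard-no (f v) (ℕP.<-irrefl v≡m ∘ ℕP.<ᵇ⇒< (toℕ v) m))
                                                     (guard-yes (f v) (fromWitness a≡v))) ⟩
    guard (toℕ v <ᵇ m) (f v) +ℚ guard ⌊ a ≟ v ⌋ (f v) ∎
    where a≡v = toℕ-injective (trans a≡m (sym v≡m))
  ... | tri> _ _ m<v = begin
    guard (toℕ v <ᵇ suc m) (f v)  ≡⟨ guard-no (f v) (ℕP.<⇒≱ m<v ∘ ℕP.≤-pred ∘ ℕP.<ᵇ⇒< (toℕ v) (suc m)) ⟩
    0ℚ                            ≡⟨ sym (cong₂ _+ℚ_ (guard-no (f v) (ℕP.<-asym m<v ∘ ℕP.<ᵇ⇒< (toℕ v) m))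
                                                     (guard-no (f v) (ℕP.<⇒≢ m<v ∘ sym ∘ a≡v⇒v≡m ∘ toWitness))) ⟩
    guard (toℕ v <ᵇ m) (f v) +ℚ guard ⌊ a ≟ v ⌋ (f v) ∎

Edge : ∀ {n} → EdgeSet n → Fin n → Fin n → Set
Edge S a b = toℕ a < toℕ b × T (S a b)

isEdge : ∀ {n} → EdgeSet n → Fin n → Fin n → Bool
isEdge S i j = (toℕ i <ᵇ toℕ j) ∧ S i j

isEdge⇒Edge : ∀ {n} (S : EdgeSet n) {i j} → T (isEdge S i j) → Edge S i j
isEdge⇒Edge S {i} {j} t with Equivalence.to T-∧ t
... | i<ᵇj , s = ℕP.<ᵇ⇒< (toℕ i) (toℕ j) i<ᵇj , s

Edge⇒isEdge : ∀ {n} (S : EdgeSet n) {i j} → Edge S i j → T (isEdge S i j)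
Edge⇒isEdge S (i<j , s) = Equivalence.from T-∧ (ℕP.<⇒<ᵇ i<j , s)

module Flow {n : ℕ} (S : EdgeSet n) (c : Fin n → Fin n → ℚ) where

  weight : Fin n → Fin n → ℚ
  weight i j = guard (isEdge S i j) (c i j)

  up : Fin n → ℚ
  up v = sumFin n (weight v)

  down : Fin n → ℚ
  down v = sumFin n (λ u → weight u v)

  weight-off-edge : ∀ i j → ¬ Edge S i j → weight i j ≡ 0ℚ
  weight-off-edge i j ¬e = guard-no (c i j) (¬e ∘ isEdge⇒Edge S)

  weight-supported : (∀ i j → ¬ Edge S i j → c i j ≡ 0ℚ) → ∀ i j → weight i j ≡ c i j
  weight-supported c-off i j with isEdge S i j in eq
  ... | true  = refl
  ... | false = sym (c-off i j (λ e → subst T eq (Edge⇒isEdge S e)))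

  nonzero-weight⇒Edge : ∀ i j → weight i j ≢ 0ℚ → Edge S i j
  nonzero-weight⇒Edge i j w≢0 with isEdge S i j in eq
  ... | true  = isEdge⇒Edge S (subst T (sym eq) tt)
  ... | false = ⊥-elim (w≢0 refl)

Balanced : (n : ℕ) → EdgeSet n → (Fin n → Fin n → ℚ) → Set
Balanced n S c = ∀ v → up v ≡ 0ℚ × down v ≡ 0ℚ
  where open Flow S c

attach-mono : ∀ {n} {i j : Fin n} → toℕ i ≤ toℕ j → attach n i ≤ attach n j
attach-mono {n} i≤j = ℕP.⊓-monoˡ-≤ (n ∸ 3) (ℕP.∸-monoˡ-≤ 1 i≤j)

attach≤⇔ : ∀ {n} (l : Fin n) {K} → K < n ∸ 3 → attach n l ≤ K ⇔ toℕ l ≤ suc K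
attach≤⇔ {n} l {K} K<n∸3 = mk⇔ to from
  where
  to : attach n l ≤ K → toℕ l ≤ suc K
  to a≤K = ℕP.≤-trans (ℕP.m≤n+m∸n (toℕ l) 1) (s≤s l∸1≤K)
    where
    l∸1≤K : toℕ l ∸ 1 ≤ K
    l∸1≤K = ℕP.≮⇒≥ (λ K<l∸1 → ℕP.<⇒≱ (ℕP.⊓-glb K<l∸1 K<n∸3) a≤K)
  from : toℕ l ≤ suc K → attach n l ≤ K
  from l≤1+K = ℕP.≤-trans (ℕP.m⊓n≤m (toℕ l ∸ 1) (n ∸ 3)) (ℕP.∸-monoˡ-≤ 1 l≤1+K)

on-spine⇔ : ∀ {n} {i j : Fin n} (k : Fin (n ∸ 3)) → toℕ i < toℕ j →
  T (onPath n i j (spine k)) ⇔ (toℕ i < 2 + toℕ k × 2 + toℕ k ≤ toℕ j)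
on-spine⇔ {n} {i} {j} k i<j
  rewrite ℕP.m≤n⇒m⊓n≡m (attach-mono {n} {i} {j} (ℕP.<⇒≤ i<j))
        | ℕP.m≤n⇒m⊔n≡n (attach-mono {n} {i} {j} (ℕP.<⇒≤ i<j)) = mk⇔ to from
  where
  K = toℕ k
  K<n∸3 = toℕ<n k
  to : T ((attach n i ≤ᵇ K) ∧ (K <ᵇ attach n j)) → toℕ i < 2 + K × 2 + K ≤ toℕ j
  to t with Equivalence.to T-∧ t
  ... | ai≤ᵇK , K<ᵇaj =
    s≤s (Equivalence.to (attach≤⇔ i K<n∸3) (ℕP.≤ᵇ⇒≤ _ K ai≤ᵇK)) ,
    ℕP.≰⇒> (λ j≤1+K → ℕP.<⇒≱ (ℕP.<ᵇ⇒< K _ K<ᵇaj)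
                               (Equivalence.from (attach≤⇔ j K<n∸3) j≤1+K))
  from : toℕ i < 2 + K × 2 + K ≤ toℕ j → T ((attach n i ≤ᵇ K) ∧ (K <ᵇ attach n j))
  from (i<2+K , 2+K≤j) = Equivalence.from T-∧
    ( ℕP.≤⇒≤ᵇ (Equivalence.from (attach≤⇔ i K<n∸3) (ℕP.≤-pred i<2+K))
    , ℕP.<⇒<ᵇ (ℕP.≰⇒> (λ aj≤K → ℕP.<⇒≱ 2+K≤j (Equivalence.to (attach≤⇔ j K<n∸3) aj≤K))))

module CatFlow {n : ℕ} (S : EdgeSet n) (c : Fin n → Fin n → ℚ) where
  open Flow S c

  private
    edge-of : ∀ {i j} → isEdge S i j ≡ true → Edge S i j
    edge-of e = isEdge⇒Edge S (subst T (sym e) tt)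

  pendant-term : ∀ l i j →
    guard (isEdge S i j) (c i j * λCat n i j (pendant l))
      ≡ guard ⌊ l ≟ i ⌋ (weight i j) +ℚ guard ⌊ l ≟ j ⌋ (weight i j)
  pendant-term l i j with isEdge S i j in e
  ... | false = sym (cong₂ _+ℚ_ (guard-zero ⌊ l ≟ i ⌋) (guard-zero ⌊ l ≟ j ⌋))
  ... | true with l ≟ i | l ≟ j
  ...   | yes refl | yes refl = ⊥-elim (ℕP.<-irrefl refl (proj₁ (edge-of e)))
  ...   | yes _    | no _     = trans (ℚP.*-identityʳ (c i j)) (sym (ℚP.+-identityʳ (c i j)))
  ...   | no _     | yes _    = trans (ℚP.*-identityʳ (c i j)) (sym (ℚP.+-identityˡ (c i j)))
  ...   | no _     | no _     = ℚP.*-zeroʳ (c i j)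

  spine-term : ∀ (k : Fin (n ∸ 3)) i j →
    guard (isEdge S i j) (c i j * λCat n i j (spine k))
      ≡ guard (toℕ i <ᵇ 2 + toℕ k) (weight i j) - guard (toℕ j <ᵇ 2 + toℕ k) (weight i j)
  spine-term k i j with isEdge S i j in e
  ... | false = sym (cong₂ _-_ (guard-zero (toℕ i <ᵇ 2 + toℕ k)) (guard-zero (toℕ j <ᵇ 2 + toℕ k)))
  ... | true
    with toℕ i <ᵇ 2 + toℕ k | ℕP.<ᵇ-reflects-< (toℕ i) (2 + toℕ k)
       | toℕ j <ᵇ 2 + toℕ k | ℕP.<ᵇ-reflects-< (toℕ j) (2 + toℕ k)
  ...   | true | ofʸ _ | true | ofʸ j<m =
          trans (cong (c i j *_) (guard-no 1ℚ (λ t → ℕP.<⇒≱ j<m (proj₂ (cut t)))))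
                (trans (ℚP.*-zeroʳ (c i j)) (sym (ℚP.+-inverseʳ (c i j))))
    where cut = Equivalence.to (on-spine⇔ k (proj₁ (edge-of e)))
  ...   | true | ofʸ i<m | false | ofⁿ j≮m =
          trans (cong (c i j *_) (guard-yes 1ℚ (Equivalence.from (on-spine⇔ k (proj₁ (edge-of e)))
                                                                (i<m , ℕP.≮⇒≥ j≮m))))
                (trans (ℚP.*-identityʳ (c i j)) (sym (ℚP.+-identityʳ (c i j))))
  ...   | false | ofⁿ i≮m | true | ofʸ j<m = ⊥-elim (i≮m (ℕP.<-trans (proj₁ (edge-of e)) j<m))
  ...   | false | ofⁿ i≮m | false | ofⁿ _ =
          trans (cong (c i j *_) (guard-no 1ℚ (λ t → i≮m (proj₁ (cut t))))) (ℚP.*-zeroʳ (c i j))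
    where cut = Equivalence.to (on-spine⇔ k (proj₁ (edge-of e)))

  pendant-flow : ∀ l → combo n S c (pendant l) ≡ up l +ℚ down l
  pendant-flow l = begin
    combo n S c (pendant l)
      ≡⟨ sum-cong n (λ i → sum-cong n (pendant-term l i)) ⟩
    sumFin n (λ i → sumFin n (λ j → guard ⌊ l ≟ i ⌋ (weight i j) +ℚ guard ⌊ l ≟ j ⌋ (weight i j)))
      ≡⟨ sum-cong n (λ i → sum-+ n _ _) ⟩
    sumFin n (λ i → sumFin n (λ j → guard ⌊ l ≟ i ⌋ (weight i j))
                    +ℚ sumFin n (λ j → guard ⌊ l ≟ j ⌋ (weight i j)))
      ≡⟨ sum-+ n _ _ ⟩
    sumFin n (λ i → sumFin n (λ j → guard ⌊ l ≟ i ⌋ (weight i j)))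
      +ℚ sumFin n (λ i → sumFin n (λ j → guard ⌊ l ≟ j ⌋ (weight i j)))
      ≡⟨ cong₂ _+ℚ_ (sum-cong n (λ i → sum-guard n ⌊ l ≟ i ⌋ (weight i)))
                    (sum-cong n (λ i → sum-point n (weight i) l)) ⟩
    sumFin n (λ i → guard ⌊ l ≟ i ⌋ (up i)) +ℚ down l
      ≡⟨ cong (_+ℚ down l) (sum-point n up l) ⟩
    up l +ℚ down l ∎
    where open ≡-Reasoning

  spine-flow : ∀ k → combo n S c (spine k) ≡ below (2 + toℕ k) up - below (2 + toℕ k) down
  spine-flow k = begin
    combo n S c (spine k)
      ≡⟨ sum-cong n (λ i → sum-cong n (spine-term k i)) ⟩
    sumFin n (λ i → sumFin n (λ j → guard (toℕ i <ᵇ m) (weight i j) - guard (toℕ j <ᵇ m) (weight i j)))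
      ≡⟨ sum-cong n (λ i → sum-- n _ _) ⟩
    sumFin n (λ i → sumFin n (λ j → guard (toℕ i <ᵇ m) (weight i j))
                    - sumFin n (λ j → guard (toℕ j <ᵇ m) (weight i j)))
      ≡⟨ sum-- n _ _ ⟩
    sumFin n (λ i → sumFin n (λ j → guard (toℕ i <ᵇ m) (weight i j)))
      - sumFin n (λ i → sumFin n (λ j → guard (toℕ j <ᵇ m) (weight i j)))
      ≡⟨ cong₂ _-_ (sum-cong n (λ i → sum-guard n (toℕ i <ᵇ m) (weight i)))
                   (trans (sum-swap n n _) (sum-cong n (λ j → sum-guard n (toℕ j <ᵇ m) (λ i → weight i j)))) ⟩
    below m up - below m down ∎
    where open ≡-Reasoning
          m = 2 + toℕ k

Relation : (n : ℕ) → EdgeSet n → (Fin n → Fin n → ℚ) → Set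
Relation n S c = (e : CatEdge n) → combo n S c e ≡ 0ℚ

balanced⇒relation : ∀ {n} (S : EdgeSet n) (c : Fin n → Fin n → ℚ) →
  Balanced n S c → Relation n S c
balanced⇒relation {n} S c bal (pendant l) =
  trans (pendant-flow l) (cong₂ _+ℚ_ (proj₁ (bal l)) (proj₂ (bal l)))
  where open CatFlow S c
balanced⇒relation {n} S c bal (spine k) =
  trans (spine-flow k) (cong₂ _-_ (below-zero m up (proj₁ ∘ bal)) (below-zero m down (proj₂ ∘ bal)))
  where open Flow S c
        open CatFlow S c
        m = 2 + toℕ k

-- The pendant coordinates give
-- down = - up; then each cut coordinate is twice the prefix sum
-- below m up, so these prefix sums vanish for 2 ≤ m ≤ n - 2, and also
-- for m ≤ 1 and m ≥ n - 1 because the first vertex has no smaller and the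
-- last no larger neighbour.  Hence up v, a difference of two consecutive
-- prefix sums, vanishes.
module RelationIsBalanced {n : ℕ} (S : EdgeSet n) (c : Fin n → Fin n → ℚ)
                          (rel : Relation n S c) where
  open Flow S c
  open CatFlow S c

  down≡-up : ∀ v → down v ≡ - up v
  down≡-up v = inverseʳ-unique (up v) (down v) (trans (sym (pendant-flow v)) (rel (pendant v)))

  below-down : ∀ m → below m down ≡ - below m up
  below-down m = trans (sum-cong n guard-neg) (sum-neg n _)
    where
    guard-neg : ∀ v → guard (toℕ v <ᵇ m) (down v) ≡ - guard (toℕ v <ᵇ m) (up v)
    guard-neg v with toℕ v <ᵇ m
    ... | true  = down≡-up v
    ... | false = refl

  cut-zero : ∀ (k : Fin (n ∸ 3)) → below (2 + toℕ k) up ≡ 0ℚ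
  cut-zero k = double-zero B (begin
    B +ℚ B          ≡⟨ cong (B +ℚ_) (sym (⁻¹-involutive B)) ⟩
    B - (- B)       ≡⟨ cong (λ x → B - x) (sym (below-down (2 + toℕ k))) ⟩
    B - below (2 + toℕ k) down ≡⟨ sym (spine-flow k) ⟩
    combo n S c (spine k)      ≡⟨ rel (spine k) ⟩
    0ℚ ∎)
    where open ≡-Reasoning
          B = below (2 + toℕ k) up

  up-last : ∀ a → suc (toℕ a) ≡ n → up a ≡ 0ℚ
  up-last a a+1≡n = sum-zero n (λ j → weight-off-edge a j (λ (a<j , _) →
    ℕP.<⇒≱ a<j (ℕP.≤-pred (subst (toℕ j <_) (sym a+1≡n) (toℕ<n j)))))

  down-first : ∀ a → toℕ a ≡ 0 → down a ≡ 0ℚ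
  down-first a a≡0 = sum-zero n (λ i → weight-off-edge i a (λ (i<a , _) →
    ℕP.n≮0 (subst (toℕ i <_) a≡0 i<a)))

  total-up : sumFin n up ≡ 0ℚ
  total-up = double-zero (sumFin n up) (begin
    sumFin n up +ℚ sumFin n up    ≡⟨ cong (sumFin n up +ℚ_) (sum-swap n n weight) ⟩
    sumFin n up +ℚ sumFin n down  ≡⟨ cong (sumFin n up +ℚ_) (trans (sum-cong n down≡-up) (sum-neg n up)) ⟩
    sumFin n up - sumFin n up     ≡⟨ ℚP.+-inverseʳ (sumFin n up) ⟩
    0ℚ ∎)
    where open ≡-Reasoning

  prefix-zero : ∀ m → m ≤ n → below m up ≡ 0ℚ
  prefix-zero zero          _   = below-none up
  prefix-zero (suc zero)    1≤n = begin
    below 1 up           ≡⟨ below-step up a (toℕ-fromℕ< 1≤n) ⟩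
    below 0 up +ℚ up a   ≡⟨ cong₂ _+ℚ_ (below-none up) (begin
      up a                   ≡⟨ sym (⁻¹-involutive (up a)) ⟩
      - (- up a)             ≡⟨ cong -_ (sym (down≡-up a)) ⟩
      - down a               ≡⟨ cong -_ (down-first a (toℕ-fromℕ< 1≤n)) ⟩
      0ℚ ∎) ⟩
    0ℚ ∎
    where open ≡-Reasoning
          a = fromℕ< 1≤n
  prefix-zero (suc (suc m)) m+2≤n with m ℕP.<? n ∸ 3 | ℕP.m≤n⇒m<n∨m≡n m+2≤n
  ... | yes m<n∸3 | _ =
    subst (λ x → below (2 + x) up ≡ 0ℚ) (toℕ-fromℕ< m<n∸3) (cut-zero (fromℕ< m<n∸3))
  ... | no _     | inj₂ refl = trans (below-all up) total-up
  ... | no m≮n∸3 | inj₁ m+2<n = begin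
    below (2 + m) up                ≡⟨ sym (ℚP.+-identityʳ _) ⟩
    below (2 + m) up +ℚ 0ℚ          ≡⟨ cong (below (2 + m) up +ℚ_) (sym (up-last a a+1≡n)) ⟩
    below (2 + m) up +ℚ up a        ≡⟨ sym (below-step up a (toℕ-fromℕ< m+2<n)) ⟩
    below (3 + m) up                ≡⟨ cong (λ x → below x up) m+3≡n ⟩
    below n up                      ≡⟨ trans (below-all up) total-up ⟩
    0ℚ ∎
    where
    open ≡-Reasoning
    a = fromℕ< m+2<n
    m+3≡n : 3 + m ≡ n
    m+3≡n = ℕP.≤-antisym m+2<n
      (ℕP.≤-trans (ℕP.m≤n+m∸n n 3) (ℕP.+-monoʳ-≤ 3 (ℕP.≮⇒≥ m≮n∸3)))
    a+1≡n : suc (toℕ a) ≡ n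
    a+1≡n = trans (cong suc (toℕ-fromℕ< m+2<n)) m+3≡n

  balanced : Balanced n S c
  balanced v = up≡0 , trans (down≡-up v) (cong -_ up≡0)
    where
    up≡0 : up v ≡ 0ℚ
    up≡0 = begin
      up v                                 ≡⟨ sym (ℚP.+-identityˡ (up v)) ⟩
      0ℚ +ℚ up v                           ≡⟨ cong (_+ℚ up v) (sym (prefix-zero (toℕ v) (ℕP.<⇒≤ (toℕ<n v)))) ⟩
      below (toℕ v) up +ℚ up v             ≡⟨ sym (below-step up v refl) ⟩
      below (suc (toℕ v)) up               ≡⟨ prefix-zero (suc (toℕ v)) (toℕ<n v) ⟩
      0ℚ ∎
      where open ≡-Reasoning

relation⇒balanced : ∀ {n} (S : EdgeSet n) (c : Fin n → Fin n → ℚ) →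
  Relation n S c → Balanced n S c
relation⇒balanced S c rel = RelationIsBalanced.balanced S c rel

record Zigzag {n : ℕ} (S : EdgeSet n) (k : ℕ) : Set where
  field
    peak valley : ℕ → Fin n
    closed  : peak k ≡ peak 0
    descent : ∀ {h} → h < k → Edge S (valley h) (peak h)
    ascent  : ∀ {h} → h < k → Edge S (valley h) (peak (suc h))

FirstDescentOnce : ∀ {n} {S : EdgeSet n} {k} → Zigzag S k → Set
FirstDescentOnce {k = k} Z =
  (∀ {h} → 0 < h → h < k → ¬ (valley h ≡ valley 0 × peak h ≡ peak 0)) ×
  (∀ {h} → h < k → ¬ (valley h ≡ valley 0 × peak (suc h) ≡ peak 0))
  where open Zigzag Z

unit : ∀ {n} → Fin n → Fin n → Fin n → Fin n → ℚ
unit q p a b = guard ⌊ q ≟ a ⌋ (guard ⌊ p ≟ b ⌋ 1ℚ)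

unit-row : ∀ {n} (q p a : Fin n) → sumFin n (unit q p a) ≡ guard ⌊ q ≟ a ⌋ 1ℚ
unit-row {n} q p a =
  trans (sum-guard n ⌊ q ≟ a ⌋ (λ b → guard ⌊ p ≟ b ⌋ 1ℚ)) (cong (guard ⌊ q ≟ a ⌋) (sum-point n _ p))

unit-column : ∀ {n} (q p b : Fin n) → sumFin n (λ a → unit q p a b) ≡ guard ⌊ p ≟ b ⌋ 1ℚ
unit-column {n} q p b = begin
  sumFin n (λ a → unit q p a b)                          ≡⟨ sum-cong n (λ a → guard-comm ⌊ q ≟ a ⌋ ⌊ p ≟ b ⌋ 1ℚ) ⟩
  sumFin n (λ a → guard ⌊ p ≟ b ⌋ (guard ⌊ q ≟ a ⌋ 1ℚ)) ≡⟨ sum-guard n ⌊ p ≟ b ⌋ _ ⟩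
  guard ⌊ p ≟ b ⌋ (sumFin n (λ a → guard ⌊ q ≟ a ⌋ 1ℚ)) ≡⟨ cong (guard ⌊ p ≟ b ⌋) (sum-point n _ q) ⟩
  guard ⌊ p ≟ b ⌋ 1ℚ ∎
  where open ≡-Reasoning

unit-diagonal : ∀ {n} (a b : Fin n) → unit a b a b ≡ 1ℚ
unit-diagonal a b =
  trans (guard-yes (guard ⌊ b ≟ b ⌋ 1ℚ) (fromWitness {a? = a ≟ a} refl))
        (guard-yes 1ℚ (fromWitness {a? = b ≟ b} refl))

unit-off : ∀ {n} (q p a b : Fin n) → ¬ (q ≡ a × p ≡ b) → unit q p a b ≡ 0ℚ
unit-off q p a b ≢ with q ≟ a | p ≟ b
... | yes q≡a | yes p≡b = ⊥-elim (≢ (q≡a , p≡b))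
... | yes _   | no _    = refl
... | no _    | _       = refl

-- A zigzag whose first descent is traversed only once makes S dependent:
-- weight its descents +1 and its ascents −1.  At every valley the weights
-- of its two edges cancel, at every peak they telescope along the cycle, so
-- the weighting is balanced, hence a relation; yet its coefficient on the
-- first descent is 1.
module ZigzagRelation {n : ℕ} {S : EdgeSet n} {k′ : ℕ} (Z : Zigzag S (suc k′)) where
  open Zigzag Z
  k = suc k′

  step : ℕ → Fin n → Fin n → ℚ
  step h a b = unit (valley h) (peak h) a b - unit (valley h) (peak (suc h)) a b

  c : Fin n → Fin n → ℚ
  c a b = sumFin k (λ h → step (toℕ h) a b)

  open Flow S c

  c-off-edge : ∀ a b → ¬ Edge S a b → c a b ≡ 0ℚ
  c-off-edge a b ¬e = sum-zero k {f = λ h → step (toℕ h) a b} (λ h →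
    cong₂ _-_ (unit-off (valley (toℕ h)) (peak (toℕ h)) a b (λ { (refl , refl) → ¬e (descent (toℕ<n h)) }))
              (unit-off (valley (toℕ h)) (peak (suc (toℕ h))) a b (λ { (refl , refl) → ¬e (ascent (toℕ<n h)) })))

  up-zero : ∀ a → up a ≡ 0ℚ
  up-zero a = begin
    sumFin n (weight a)                                    ≡⟨ sum-cong n (weight-supported c-off-edge a) ⟩
    sumFin n (λ b → sumFin k (λ h → step (toℕ h) a b))     ≡⟨ sum-swap n k (λ b h → step (toℕ h) a b) ⟩
    sumFin k (λ h → sumFin n (step (toℕ h) a))
      ≡⟨ sum-cong k (λ h → sum-- n (unit (valley (toℕ h)) (peak (toℕ h)) a)
                                   (unit (valley (toℕ h)) (peak (suc (toℕ h))) a)) ⟩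
    sumFin k (λ h → sumFin n (unit (valley (toℕ h)) (peak (toℕ h)) a)
                    - sumFin n (unit (valley (toℕ h)) (peak (suc (toℕ h))) a))
      ≡⟨ sum-zero k (λ h → trans (cong₂ _-_ (unit-row (valley (toℕ h)) (peak (toℕ h)) a)
                                               (unit-row (valley (toℕ h)) (peak (suc (toℕ h))) a))
                                 (ℚP.+-inverseʳ (guard ⌊ valley (toℕ h) ≟ a ⌋ 1ℚ))) ⟩
    0ℚ ∎
    where open ≡-Reasoning

  down-zero : ∀ b → down b ≡ 0ℚ
  down-zero b = begin
    sumFin n (λ a → weight a b)                            ≡⟨ sum-cong n (λ a → weight-supported c-off-edge a b) ⟩
    sumFin n (λ a → sumFin k (λ h → step (toℕ h) a b))     ≡⟨ sum-swap n k (λ a h → step (toℕ h) a b) ⟩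
    sumFin k (λ h → sumFin n (λ a → step (toℕ h) a b))
      ≡⟨ sum-cong k (λ h → sum-- n (λ a → unit (valley (toℕ h)) (peak (toℕ h)) a b)
                                   (λ a → unit (valley (toℕ h)) (peak (suc (toℕ h))) a b)) ⟩
    sumFin k (λ h → sumFin n (λ a → unit (valley (toℕ h)) (peak (toℕ h)) a b)
                    - sumFin n (λ a → unit (valley (toℕ h)) (peak (suc (toℕ h))) a b))
      ≡⟨ sum-cong k (λ h → cong₂ _-_ (unit-column (valley (toℕ h)) (peak (toℕ h)) b)
                                             (unit-column (valley (toℕ h)) (peak (suc (toℕ h))) b)) ⟩
    sumFin k (λ h → atPeak (toℕ h) - atPeak (suc (toℕ h)))  ≡⟨ telescope k atPeak ⟩
    atPeak 0 - atPeak k                                    ≡⟨ cong (λ p → atPeak 0 - guard ⌊ p ≟ b ⌋ 1ℚ) closed ⟩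
    atPeak 0 - atPeak 0                                    ≡⟨ ℚP.+-inverseʳ (atPeak 0) ⟩
    0ℚ ∎
    where open ≡-Reasoning
          atPeak : ℕ → ℚ
          atPeak h = guard ⌊ peak h ≟ b ⌋ 1ℚ

  balanced : Balanced n S c
  balanced v = up-zero v , down-zero v

  first-coefficient : FirstDescentOnce Z → c (valley 0) (peak 0) ≡ 1ℚ
  first-coefficient (descents-differ , ascents-differ) = begin
    step 0 q₀ p₀ +ℚ sumFin k′ (λ h → step (suc (toℕ h)) q₀ p₀)
      ≡⟨ cong₂ _+ℚ_ (cong₂ _-_ (unit-diagonal q₀ p₀) (unit-off q₀ (peak 1) q₀ p₀ (ascents-differ (s≤s z≤n))))
                    (sum-zero k′ (λ h → cong₂ _-_
                      (unit-off (valley (suc (toℕ h))) (peak (suc (toℕ h))) q₀ p₀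
                                (descents-differ (s≤s z≤n) (s≤s (toℕ<n h))))
                      (unit-off (valley (suc (toℕ h))) (peak (suc (suc (toℕ h)))) q₀ p₀
                                (ascents-differ (s≤s (toℕ<n h)))))) ⟩
    1ℚ ∎
    where open ≡-Reasoning
          q₀ = valley 0
          p₀ = peak 0

zigzag⇒dependent : ∀ {n} {S : EdgeSet n} {k′} (Z : Zigzag S (suc k′)) →
  FirstDescentOnce Z → ¬ IndependentCat n S
zigzag⇒dependent Z once indep = 1≢0 (trans (sym (first-coefficient once))
  (indep c (balanced⇒relation _ c balanced) (valley 0) (peak 0) (proj₁ first-edge) (proj₂ first-edge)))
  where
  open Zigzag Z
  open ZigzagRelation Z
  first-edge = descent (s≤s z≤n)
  1≢0 : 1ℚ ≢ 0ℚ
  1≢0 ()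

module Positions (k′ : ℕ) where
  k N : ℕ
  k = suc k′
  N = suc (k′ + suc k′)     -- = k + k

  pos : ℕ → Fin N
  pos u = u mod N

  toℕ-pos : ∀ {u} → u < N → toℕ (pos u) ≡ u
  toℕ-pos u<N = trans (toℕ-fromℕ< _) (m<n⇒m%n≡m u<N)

  next-pos : ∀ {u} → u < N → next (k′ + suc k′) (pos u) ≡ pos (suc u)
  next-pos u<N = cong (λ x → suc x mod N) (toℕ-pos u<N)

  pos-N : pos N ≡ pos 0
  pos-N = toℕ-injective (trans (toℕ-fromℕ< _) (n%n≡0 N))

  pos-injective : ∀ {u w} → u < N → w < N → pos u ≡ pos w → u ≡ w
  pos-injective u<N w<N eq = trans (sym (toℕ-pos u<N)) (trans (cong toℕ eq) (toℕ-pos w<N))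

  odd-bound : ∀ {h} → h < k → suc (h + h) < N
  odd-bound {h} h<k = subst (_≤ N) (cong suc (ℕP.+-suc h h)) (ℕP.+-mono-≤ h<k h<k)

  even-bound : ∀ {h} → h < k → h + h < N
  even-bound h<k = ℕP.<-trans (ℕP.n<1+n _) (odd-bound h<k)

double%2 : ∀ h → (h + h) % 2 ≡ 0
double%2 zero    = refl
double%2 (suc h) = trans (cong (λ x → suc x % 2) (ℕP.+-suc h h)) (double%2 h)

double+1%2 : ∀ h → suc (h + h) % 2 ≡ 1
double+1%2 zero    = refl
double+1%2 (suc h) = trans (cong (λ x → suc (suc x) % 2) (ℕP.+-suc h h)) (double+1%2 h)

adj-downward : ∀ {n} {S : EdgeSet n} {a b} → Adj n S a b → toℕ b < toℕ a → Edge S b a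
adj-downward (inj₁ (a<b , _)) b<a = ⊥-elim (ℕP.<-asym a<b b<a)
adj-downward (inj₂ e)         _   = e

adj-upward : ∀ {n} {S : EdgeSet n} {a b} → Adj n S a b → toℕ a < toℕ b → Edge S a b
adj-upward (inj₁ e)         _   = e
adj-upward (inj₂ (b<a , _)) a<b = ⊥-elim (ℕP.<-asym a<b b<a)

-- A closed alternating trail v_0 v_1 … v_{2k-1} is a zigzag with peaks
-- v_{2h} and valleys v_{2h+1}; since its edges are distinct, its first
-- descent v_0 v_1 is traversed only once.
module TrailZigzag {n : ℕ} {S : EdgeSet n} {k′ : ℕ} (tr : AltClosedTrail n S k′) where
  open AltClosedTrail tr
  open Positions k′

  vertex : ℕ → Fin n
  vertex u = v (pos u)

  next-vertex : ∀ {u} → u < N → v (next (k′ + suc k′) (pos u)) ≡ vertex (suc u)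
  next-vertex u<N = cong v (next-pos u<N)

  step : ∀ {u} → u < N → Adj n S (vertex u) (vertex (suc u))
  step {u} u<N = subst (Adj n S (vertex u)) (next-vertex u<N) (edges (pos u))

  step-distinct : ∀ {u w} → u < N → w < N → u ≢ w →
    ¬ SameEdge (vertex u) (vertex (suc u)) (vertex w) (vertex (suc w))
  step-distinct {u} {w} u<N w<N u≢w same = distinct (pos u) (pos w) (u≢w ∘ pos-injective u<N w<N)
    (subst₂ (λ x y → SameEdge (vertex u) x (vertex w) y) (sym (next-vertex u<N)) (sym (next-vertex w<N)) same)

  drop : ∀ {h} → h < k → toℕ (vertex (suc (h + h))) < toℕ (vertex (h + h))
  drop {h} h<k = subst (λ x → toℕ x < toℕ (vertex (h + h))) (next-vertex (even-bound h<k))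
    (altEven (pos (h + h)) (trans (cong (_% 2) (toℕ-pos (even-bound h<k))) (double%2 h)))

  rise : ∀ {h} → h < k → toℕ (vertex (suc (h + h))) < toℕ (vertex (suc (suc (h + h))))
  rise {h} h<k = subst (λ x → toℕ (vertex (suc (h + h))) < toℕ x) (next-vertex (odd-bound h<k))
    (altOdd (pos (suc (h + h))) (trans (cong (_% 2) (toℕ-pos (odd-bound h<k))) (double+1%2 h)))

  peak-suc : ∀ h → vertex (suc h + suc h) ≡ vertex (suc (suc (h + h)))
  peak-suc h = cong (vertex ∘ suc) (ℕP.+-suc h h)

  zigzag : Zigzag S k
  zigzag = record
    { peak    = λ h → vertex (h + h)
    ; valley  = λ h → vertex (suc (h + h))
    ; closed  = cong v pos-N
    ; descent = λ h<k → adj-downward {S = S} (step (even-bound h<k)) (drop h<k)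
    ; ascent  = λ {h} h<k → subst (Edge S (vertex (suc (h + h)))) (sym (peak-suc h))
                  (adj-upward {S = S} (step (odd-bound h<k)) (rise h<k))
    }

  first-descent-once : FirstDescentOnce zigzag
  first-descent-once = descents-differ , ascents-differ
    where
    descents-differ : ∀ {h} → 0 < h → h < k →
      ¬ (vertex (suc (h + h)) ≡ vertex 1 × vertex (h + h) ≡ vertex 0)
    descents-differ {suc h} _ h<k (q≡ , p≡) =
      step-distinct (s≤s z≤n) (even-bound h<k) (λ ()) (inj₁ (sym p≡ , sym q≡))
    ascents-differ : ∀ {h} → h < k →
      ¬ (vertex (suc (h + h)) ≡ vertex 1 × vertex (suc h + suc h) ≡ vertex 0)
    ascents-differ {h} h<k (q≡ , p≡) =
      step-distinct (s≤s z≤n) (odd-bound h<k) (λ ())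
        (inj₂ (trans (sym p≡) (peak-suc h) , sym q≡))

trail⇒dependent : ∀ {n} {S : EdgeSet n} → HasAltClosedTrail n S → ¬ IndependentCat n S
trail⇒dependent (_ , tr) = zigzag⇒dependent zigzag first-descent-once
  where open TrailZigzag tr

module _ {n : ℕ} {S : EdgeSet n} {k′ : ℕ} (Z : Zigzag S (suc k′)) where
  open Zigzag Z

  record Simple : Set where
    field
      peaks-distinct : ∀ {a b} → a < suc k′ → b < suc k′ → peak a ≡ peak b → a ≡ b
      valleys-turn   : ∀ {h} → suc h < suc k′ → valley (suc h) ≢ valley h
      valleys-wrap   : valley k′ ≢ valley 0

interleave : {A : Set} → (ℕ → A) → (ℕ → A) → ℕ → A
interleave p q zero    = p 0
interleave p q (suc u) = interleave q (p ∘ suc) u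

interleave-even : {A : Set} (p q : ℕ → A) (h : ℕ) → interleave p q (h + h) ≡ p h
interleave-even p q zero    = refl
interleave-even p q (suc h) =
  trans (cong (interleave q (p ∘ suc)) (ℕP.+-suc h h)) (interleave-even (p ∘ suc) (q ∘ suc) h)

interleave-odd : {A : Set} (p q : ℕ → A) (h : ℕ) → interleave p q (suc (h + h)) ≡ q h
interleave-odd p q = interleave-even q (p ∘ suc)

parity : ∀ u → Σ ℕ λ h → u ≡ h + h ⊎ u ≡ suc (h + h)
parity zero    = 0 , inj₁ refl
parity (suc u) with parity u
... | h , inj₁ u≡2h   = h , inj₂ (cong suc u≡2h)
... | h , inj₂ u≡2h+1 = suc h , inj₁ (trans (cong suc u≡2h+1) (cong suc (sym (ℕP.+-suc h h))))

half-bound : ∀ {h k} → h + h < k + k → h < k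
half-bound h+h<k+k = ℕP.≰⇒> (λ k≤h → ℕP.<⇒≱ h+h<k+k (ℕP.+-mono-≤ k≤h k≤h))

SameEdge-swapˡ : ∀ {n} {a b c d : Fin n} → SameEdge a b c d → SameEdge b a c d
SameEdge-swapˡ (inj₁ (a≡c , b≡d)) = inj₂ (b≡d , a≡c)
SameEdge-swapˡ (inj₂ (a≡d , b≡c)) = inj₁ (b≡c , a≡d)

SameEdge-swapʳ : ∀ {n} {a b c d : Fin n} → SameEdge a b c d → SameEdge a b d c
SameEdge-swapʳ (inj₁ (a≡c , b≡d)) = inj₂ (a≡c , b≡d)
SameEdge-swapʳ (inj₂ (a≡d , b≡c)) = inj₁ (a≡d , b≡c)

SameEdge-cong : ∀ {n} {a b c d a′ b′ c′ d′ : Fin n} →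
  a ≡ a′ → b ≡ b′ → c ≡ c′ → d ≡ d′ → SameEdge a b c d → SameEdge a′ b′ c′ d′
SameEdge-cong refl refl refl refl same = same

SameEdge-ordered : ∀ {n} {a b c d : Fin n} → toℕ a < toℕ b → toℕ c < toℕ d →
  SameEdge a b c d → a ≡ c × b ≡ d
SameEdge-ordered a<b c<d (inj₁ eqs)          = eqs
SameEdge-ordered a<b c<d (inj₂ (refl , refl)) = ⊥-elim (ℕP.<-asym a<b c<d)

module SimpleTrail {n : ℕ} {S : EdgeSet n} {k′ : ℕ} (Z : Zigzag S (suc k′)) (simple : Simple Z) where
  open Zigzag Z
  open Simple simple
  open Positions k′

  vertexAt : ℕ → Fin n
  vertexAt = interleave peak valley

  V : Fin N → Fin n
  V i = vertexAt (toℕ i)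

  peak-k : ∀ {a} → a < k → peak k ≡ peak a → a ≡ 0
  peak-k a<k pk≡pa = sym (peaks-distinct (s≤s z≤n) a<k (trans (sym closed) pk≡pa))

  next-peaks-distinct : ∀ {a b} → a < k → b < k → peak (suc a) ≡ peak (suc b) → a ≡ b
  next-peaks-distinct {a} {b} a<k b<k eq with ℕP.m≤n⇒m<n∨m≡n a<k | ℕP.m≤n⇒m<n∨m≡n b<k
  ... | inj₁ a+1<k | inj₁ b+1<k = ℕP.suc-injective (peaks-distinct a+1<k b+1<k eq)
  ... | inj₁ a+1<k | inj₂ refl  = case peak-k a+1<k (sym eq) of λ ()
  ... | inj₂ refl  | inj₁ b+1<k = case peak-k b+1<k eq of λ ()
  ... | inj₂ a+1≡k | inj₂ b+1≡k = ℕP.suc-injective (trans a+1≡k (sym b+1≡k))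

  descent≢ascent : ∀ {a b} → a < k → b < k → peak a ≡ peak (suc b) → valley a ≢ valley b
  descent≢ascent {a} {b} a<k b<k pa≡pb+1 qa≡qb with ℕP.m≤n⇒m<n∨m≡n b<k
  ... | inj₁ b+1<k = valleys-turn b+1<k (subst (λ x → valley x ≡ valley b)
                                               (peaks-distinct a<k b+1<k pa≡pb+1) qa≡qb)
  ... | inj₂ refl  = valleys-wrap (sym (subst (λ x → valley x ≡ valley k′)
                                               (peak-k a<k (sym pa≡pb+1)) qa≡qb))

  vertexAt-wrap : ∀ {u} → u ≤ N → V (pos u) ≡ vertexAt u
  vertexAt-wrap u≤N with ℕP.m≤n⇒m<n∨m≡n u≤N
  ... | inj₁ u<N = cong vertexAt (toℕ-pos u<N)
  ... | inj₂ refl = begin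
    V (pos N)               ≡⟨ cong V pos-N ⟩
    peak 0                  ≡⟨ sym closed ⟩
    peak k                  ≡⟨ sym (interleave-even peak valley k) ⟩
    vertexAt (k + k)        ∎
    where open ≡-Reasoning

  data StepView (i : Fin N) : Set where
    descending : ∀ h → h < k → toℕ i ≡ h + h →
                 V i ≡ peak h → V (next (k′ + suc k′) i) ≡ valley h → StepView i
    ascending  : ∀ h → h < k → toℕ i ≡ suc (h + h) →
                 V i ≡ valley h → V (next (k′ + suc k′) i) ≡ peak (suc h) → StepView i

  view : ∀ i → StepView i
  view i with parity (toℕ i) | vertexAt-wrap {suc (toℕ i)} (toℕ<n i)
  ... | h , inj₁ i≡2h | next≡ =
    descending h (half-bound (subst (_< N) i≡2h (toℕ<n i))) i≡2h
      (trans (cong vertexAt i≡2h) (interleave-even peak valley h))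
      (trans next≡ (trans (cong (vertexAt ∘ suc) i≡2h) (interleave-odd peak valley h)))
  ... | h , inj₂ i≡2h+1 | next≡ =
    ascending h (half-bound (ℕP.<-trans (ℕP.n<1+n (h + h)) (subst (_< N) i≡2h+1 (toℕ<n i)))) i≡2h+1
      (trans (cong vertexAt i≡2h+1) (interleave-odd peak valley h))
      (trans next≡ (trans (cong (vertexAt ∘ suc) i≡2h+1)
        (trans (cong (vertexAt ∘ suc) (sym (ℕP.+-suc h h))) (interleave-even peak valley (suc h)))))

  edges : ∀ i → Adj n S (V i) (V (next (k′ + suc k′) i))
  edges i with view i
  ... | descending h h<k _ vi vi′ = subst₂ (Adj n S) (sym vi) (sym vi′) (inj₂ (descent h<k))
  ... | ascending  h h<k _ vi vi′ = subst₂ (Adj n S) (sym vi) (sym vi′) (inj₁ (ascent h<k))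

  alt-even : ∀ i → toℕ i % 2 ≡ 0 → toℕ (V (next (k′ + suc k′) i)) < toℕ (V i)
  alt-even i even with view i
  ... | descending h h<k _ vi vi′ =
    subst₂ (λ a b → toℕ a < toℕ b) (sym vi′) (sym vi) (proj₁ (descent h<k))
  ... | ascending  h _ i≡2h+1 _ _ =
    case trans (sym (double+1%2 h)) (trans (cong (_% 2) (sym i≡2h+1)) even) of λ ()

  alt-odd : ∀ i → toℕ i % 2 ≡ 1 → toℕ (V i) < toℕ (V (next (k′ + suc k′) i))
  alt-odd i odd with view i
  ... | ascending  h h<k _ vi vi′ =
    subst₂ (λ a b → toℕ a < toℕ b) (sym vi) (sym vi′) (proj₁ (ascent h<k))
  ... | descending h _ i≡2h _ _ =
    case trans (sym (double%2 h)) (trans (cong (_% 2) (sym i≡2h)) odd) of λ ()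

  distinct : ∀ i j → i ≢ j →
    ¬ SameEdge (V i) (V (next (k′ + suc k′) i)) (V j) (V (next (k′ + suc k′) j))
  distinct i j i≢j same with view i | view j
  ... | descending a a<k i≡2a vi vi′ | descending b b<k j≡2b vj vj′ =
    i≢j (toℕ-injective (trans i≡2a (trans (cong (λ x → x + x) a≡b) (sym j≡2b))))
    where
    ends = SameEdge-ordered (proj₁ (descent a<k)) (proj₁ (descent b<k))
             (SameEdge-swapˡ (SameEdge-swapʳ (SameEdge-cong vi vi′ vj vj′ same)))
    a≡b = peaks-distinct a<k b<k (proj₂ ends)
  ... | ascending a a<k i≡2a+1 vi vi′ | ascending b b<k j≡2b+1 vj vj′ =
    i≢j (toℕ-injective (trans i≡2a+1 (trans (cong (λ x → suc (x + x)) a≡b) (sym j≡2b+1))))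
    where
    ends = SameEdge-ordered (proj₁ (ascent a<k)) (proj₁ (ascent b<k)) (SameEdge-cong vi vi′ vj vj′ same)
    a≡b = next-peaks-distinct a<k b<k (proj₂ ends)
  ... | descending a a<k _ vi vi′ | ascending b b<k _ vj vj′ =
    descent≢ascent a<k b<k (proj₂ ends) (proj₁ ends)
    where
    ends = SameEdge-ordered (proj₁ (descent a<k)) (proj₁ (ascent b<k))
             (SameEdge-swapˡ (SameEdge-cong vi vi′ vj vj′ same))
  ... | ascending a a<k _ vi vi′ | descending b b<k _ vj vj′ =
    descent≢ascent b<k a<k (sym (proj₂ ends)) (sym (proj₁ ends))
    where
    ends = SameEdge-ordered (proj₁ (ascent a<k)) (proj₁ (descent b<k))
             (SameEdge-swapʳ (SameEdge-cong vi vi′ vj vj′ same))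

  trail : HasAltClosedTrail n S
  trail = k′ , record
    { v = V ; edges = edges ; distinct = distinct ; altEven = alt-even ; altOdd = alt-odd }

nonzero-elsewhere : ∀ m (f : Fin m → ℚ) → sumFin m f ≡ 0ℚ → ∀ a → f a ≢ 0ℚ →
  Σ (Fin m) λ b → b ≢ a × f b ≢ 0ℚ
nonzero-elsewhere m f Σf≡0 a fa≢0 with
  ¬∀⟶∃¬ m (λ b → b ≡ a ⊎ f b ≡ 0ℚ) (λ b → (b ≟ a) ⊎-dec (f b ℚP.≟ 0ℚ)) only-a
  where
  only-a : ¬ (∀ b → b ≡ a ⊎ f b ≡ 0ℚ)
  only-a all = fa≢0 (trans (sym (sum-single m f a vanish)) Σf≡0)
    where
    vanish : ∀ b → b ≢ a → f b ≡ 0ℚ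
    vanish b b≢a with all b
    ... | inj₁ b≡a  = ⊥-elim (b≢a b≡a)
    ... | inj₂ fb≡0 = fb≡0
... | b , ¬[b≡a⊎fb≡0] = b , ¬[b≡a⊎fb≡0] ∘ inj₁ , ¬[b≡a⊎fb≡0] ∘ inj₂

least-witness : (P : ℕ → Set) → (∀ m → Dec (P m)) → ∀ {m} → P m →
  Σ ℕ λ m′ → P m′ × (∀ {m″} → m″ < m′ → ¬ P m″)
least-witness P P? {m} Pm
  with ¬∀⟶∃¬-smallest (suc m) (λ j → ¬ P (toℕ j)) (λ j → ¬? (P? (toℕ j)))
         (λ none → none (Fin.fromℕ m) (subst P (sym (toℕ-fromℕ m)) Pm))
... | j , ¬¬Pj , earlier = toℕ j , decidable-stable (P? (toℕ j)) ¬¬Pj , minimal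
  where
  minimal : ∀ {m″} → m″ < toℕ j → ¬ P m″
  minimal m″<j = subst (¬_ ∘ P) (trans (toℕ-inject (fromℕ< m″<j)) (toℕ-fromℕ< m″<j))
                       (earlier (fromℕ< m″<j))

-- From a balanced weighting with a nonzero edge, walk through G(S): at a
-- valley q entered from the peak p, the vanishing up-flow of q yields
-- another peak p′ ≠ p with nonzero weight on q p′; at p′ the vanishing
-- down-flow yields another valley q′ ≠ q.  The first repeated peak closes
-- a simple zigzag.
module Walk {n : ℕ} (S : EdgeSet n) (c : Fin n → Fin n → ℚ) (bal : Balanced n S c) where
  open Flow S c

  record Corner : Set where
    field
      top bottom : Fin n
      nonzero    : weight bottom top ≢ 0ℚ
  open Corner

  -- Only the specification of a turn matters, not how it was found.
  opaque
    turn : (t : Corner) → Σ Corner λ t′ →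
      top t′ ≢ top t × bottom t′ ≢ bottom t × weight (bottom t) (top t′) ≢ 0ℚ
    turn t
      with p′ , p′≢p , qp′≢0 ← nonzero-elsewhere n (weight (bottom t)) (proj₁ (bal (bottom t))) (top t) (nonzero t)
      with q′ , q′≢q , q′p′≢0 ← nonzero-elsewhere n (λ i → weight i p′) (proj₂ (bal p′)) (bottom t) qp′≢0
      = record { top = p′ ; bottom = q′ ; nonzero = q′p′≢0 } , p′≢p , q′≢q , qp′≢0

  walk : Corner → ℕ → Corner
  walk t zero    = t
  walk t (suc s) = proj₁ (turn (walk t s))

  module _ (start : Corner) where
    P Q : ℕ → Fin n
    P s = top (walk start s)
    Q s = bottom (walk start s)

    descent-nonzero : ∀ s → weight (Q s) (P s) ≢ 0ℚ
    descent-nonzero s = nonzero (walk start s)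

    ascent-nonzero : ∀ s → weight (Q s) (P (suc s)) ≢ 0ℚ
    ascent-nonzero s = proj₂ (proj₂ (proj₂ (turn (walk start s))))

    peak-moves : ∀ s → P (suc s) ≢ P s
    peak-moves s = proj₁ (proj₂ (turn (walk start s)))

    valley-moves : ∀ s → Q (suc s) ≢ Q s
    valley-moves s = proj₁ (proj₂ (proj₂ (turn (walk start s))))

    window : ∀ s k′ →
      (∀ {a b} → a < suc k′ → b < suc k′ → P (s + a) ≡ P (s + b) → a ≡ b) →
      weight (Q (s + k′)) (P s) ≢ 0ℚ → Q (s + k′) ≢ Q s →
      Σ (Zigzag S (suc k′)) Simple
    window s k′ distinct closing last≢first = zigzag , simple
      where
      k = suc k′
      peak : ℕ → Fin n
      peak h = if h <ᵇ k then P (s + h) else P s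

      peak-inside : ∀ {h} → h < k → peak h ≡ P (s + h)
      peak-inside {h} h<k with h <ᵇ k | ℕP.<ᵇ-reflects-< h k
      ... | true  | _      = refl
      ... | false | ofⁿ h≮k = ⊥-elim (h≮k h<k)

      peak-end : peak k ≡ P s
      peak-end with k <ᵇ k | ℕP.<ᵇ-reflects-< k k
      ... | true  | ofʸ k<k = ⊥-elim (ℕP.<-irrefl refl k<k)
      ... | false | _       = refl

      edge : ∀ a b → weight (Q a) (P b) ≢ 0ℚ → Edge S (Q a) (P b)
      edge a b = nonzero-weight⇒Edge (Q a) (P b)

      ascent : ∀ {h} → h < k → Edge S (Q (s + h)) (peak (suc h))
      ascent {h} h<k with ℕP.m≤n⇒m<n∨m≡n h<k
      ... | inj₁ h+1<k = subst (Edge S (Q (s + h))) (sym (trans (peak-inside h+1<k) (cong P (ℕP.+-suc s h))))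
                               (edge (s + h) (suc (s + h)) (ascent-nonzero (s + h)))
      ... | inj₂ refl  = subst (Edge S (Q (s + k′))) (sym peak-end) (edge (s + k′) s closing)

      zigzag : Zigzag S k
      zigzag = record
        { peak    = peak
        ; valley  = λ h → Q (s + h)
        ; closed  = trans peak-end (sym (trans (peak-inside (s≤s z≤n)) (cong P (ℕP.+-identityʳ s))))
        ; descent = λ {h} h<k → subst (Edge S (Q (s + h))) (sym (peak-inside h<k)) (edge (s + h) (s + h) (descent-nonzero (s + h)))
        ; ascent  = ascent
        }

      simple : Simple zigzag
      simple = record
        { peaks-distinct = λ a<k b<k pa≡pb →
            distinct a<k b<k (trans (sym (peak-inside a<k)) (trans pa≡pb (peak-inside b<k)))
        ; valleys-turn   = λ {h} _ → valley-moves (s + h) ∘ subst (λ x → Q x ≡ Q (s + h)) (ℕP.+-suc s h)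
        ; valleys-wrap   = last≢first ∘ flip trans (cong Q (ℕP.+-identityʳ s))
        }

    PeakRepeat : ℕ → Set
    PeakRepeat m = Σ (Fin m) λ i → P (toℕ i) ≡ P m

    some-repeat : Σ ℕ PeakRepeat
    some-repeat with i , j , i<j , Pi≡Pj ← pigeonhole (ℕP.n<1+n n) (λ (x : Fin (suc n)) → P (toℕ x))
      = toℕ j , fromℕ< i<j , trans (cong P (toℕ-fromℕ< i<j)) Pi≡Pj

    -- At the first repetition P_i = P_m of a peak, the stretch from i to
    -- m - 1 closes up: if its last valley Q_{m-1} differs from Q_i it is a
    -- simple zigzag; otherwise dropping the step i leaves one.
    simple-zigzag : Σ ℕ λ k′ → Σ (Zigzag S (suc k′)) Simple
    simple-zigzag
      with m , (i , Pi≡Pm) , first ← least-witness PeakRepeat (λ m → any? (λ i → P (toℕ i) ≟ P m))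
                                                    (proj₂ some-repeat)
      = close (m ∸ suc (toℕ i)) (ℕP.m+[n∸m]≡n (toℕ<n i))
      where
      s = toℕ i

      distinct-before : ∀ {a b} → a < b → b < m → P a ≢ P b
      distinct-before a<b b<m Pa≡Pb = first b<m (fromℕ< a<b , trans (cong P (toℕ-fromℕ< a<b)) Pa≡Pb)

      distinct-from : ∀ t {e} → t + e < m →
        ∀ {a b} → a < suc e → b < suc e → P (t + a) ≡ P (t + b) → a ≡ b
      distinct-from t {e} t+e<m {a} {b} a≤e b≤e eq with ℕP.<-cmp a b
      ... | tri< a<b _ _ = ⊥-elim (distinct-before (ℕP.+-monoʳ-< t a<b) (inside b≤e) eq)
        where inside = λ {x} (x≤e : x < suc e) → ℕP.≤-<-trans (ℕP.+-monoʳ-≤ t (ℕP.≤-pred x≤e)) t+e<m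
      ... | tri≈ _ a≡b _ = a≡b
      ... | tri> _ _ b<a = ⊥-elim (distinct-before (ℕP.+-monoʳ-< t b<a) (inside a≤e) (sym eq))
        where inside = λ {x} (x≤e : x < suc e) → ℕP.≤-<-trans (ℕP.+-monoʳ-≤ t (ℕP.≤-pred x≤e)) t+e<m

      close : ∀ d → suc (s + d) ≡ m → Σ ℕ λ k′ → Σ (Zigzag S (suc k′)) Simple
      close d s+d+1≡m with Q (s + d) ≟ Q s
      ... | no last≢first = d , window s d (distinct-from s (ℕP.≤-reflexive s+d+1≡m)) closing last≢first
        where
        closing : weight (Q (s + d)) (P s) ≢ 0ℚ
        closing = subst (λ x → weight (Q (s + d)) x ≢ 0ℚ) (trans (cong P s+d+1≡m) (sym Pi≡Pm))
                        (ascent-nonzero (s + d))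
      close zero s+1≡m | yes _ =
        ⊥-elim (peak-moves s (trans (cong P (trans (cong suc (sym (ℕP.+-identityʳ s))) s+1≡m)) (sym Pi≡Pm)))
      close (suc d′) s+d+1≡m | yes last≡first =
        d′ , window (suc s) d′ (distinct-from (suc s) (subst (suc (s + d′) <_) (trans (cong suc (sym (ℕP.+-suc s d′))) s+d+1≡m) ℕP.≤-refl))
                    closing turns
        where
        last≡Qs : Q (suc s + d′) ≡ Q s
        last≡Qs = trans (cong Q (sym (ℕP.+-suc s d′))) last≡first
        closing : weight (Q (suc s + d′)) (P (suc s)) ≢ 0ℚ
        closing = subst (λ x → weight x (P (suc s)) ≢ 0ℚ) (sym last≡Qs) (ascent-nonzero s)
        turns : Q (suc s + d′) ≢ Q (suc s)
        turns eq = valley-moves s (trans (sym eq) last≡Qs)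

  trail : ∀ q p → weight q p ≢ 0ℚ → HasAltClosedTrail n S
  trail q p qp≢0 = SimpleTrail.trail Z simple
    where
    start = record { top = p ; bottom = q ; nonzero = qp≢0 }
    Z = proj₁ (proj₂ (simple-zigzag start))
    simple = proj₂ (proj₂ (simple-zigzag start))

no-trail⇒independent : ∀ {n} (S : EdgeSet n) → ¬ HasAltClosedTrail n S → IndependentCat n S
no-trail⇒independent S no-trail c rel i j i<j ij∈S with c i j ℚP.≟ 0ℚ
... | yes cij≡0 = cij≡0
... | no  cij≢0 = ⊥-elim (no-trail (Walk.trail S c (relation⇒balanced S c rel) i j weight≢0))
  where weight≢0 = cij≢0 ∘ trans (sym (guard-yes (c i j) (Edge⇒isEdge S (i<j , ij∈S))))

-- The argument does not use n ≥ 4.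
proposition3p4 : (n : ℕ) → 4 ≤ n → (S : EdgeSet n) →
    (IndependentCat n S → ¬ HasAltClosedTrail n S) × (¬ HasAltClosedTrail n S → IndependentCat n S)
proposition3p4 n _ S = (λ indep trail → trail⇒dependent trail indep) , no-trail⇒independent S
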